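{- Let $n\ge 7$, $p\ge1$ and $1\le q\le n$ be integers. Then $p^2n^{3q-1}(n+2)<\phi(G_{p,q})<p^2n^{3q-1}(n+6)$.
   Context: Fix integers $n$ and $q$ with $1\le q\le n$. The graph $B_q$ is bipartite with sides $L$ and $R=R_0\uplus R_1\uplus\cdots\uplus R_q$, where $|L|=2n^q$, $|R_0|=2n^q$, $|R_i|=n^q$ for $i\ge1$. Edges: (i) all pairs between $L$ and $R_q$; (ii) let $\mathcal L_q=\{L\}$ and for $i=q-1,\dots,1$ obtain the partition $\mathcal L_i$ of $L$ by splitting every part of $\mathcal L_{i+1}$ into $n$ equal parts ($n^{q-i}$ parts of size $2n^i$); partition $R_i$ into $n^{q-i}$ equal parts, pair the parts of $\mathcal L_i$ bijectively with those of $R_i$, and join each paired couple completely; (iii) a perfect matching between $L$ and $R_0$. $G_{p,q}$ is the disjoint union of $p$ copies of $B_q$. For a graph $G$, an ordering is a bijection $\sigma:V(G)\to\{1,\dots,|V(G)|\}$ with cost $\sum_{e\in E(G)}\min_{v\in e}\sigma(v)$, and $\phi(G)$ denotes the minimum cost over all orderings. -}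

module Defs where

open import Data.Nat using (ℕ; zero; suc; _+_; _*_; _^_; _⊓_; _≟_; NonZero)
open import Data.Nat.Properties using (m^n≢0; m*n≢0)
open import Data.Nat.DivMod using (_/_)
open import Data.Fin using (Fin; toℕ)
import Data.Fin as Fin
open import Data.Product using (_×_; _,_)
open import Data.Bool using (if_then_else_)
open import Relation.Nullary.Decidable using (⌊_⌋)
open import Function.Bundles using (_⤖_; Bijection)

sumFin : (k : ℕ) → (Fin k → ℕ) → ℕ
sumFin zero    f = 0
sumFin (suc k) f = f Fin.zero + sumFin k (λ i → f (Fin.suc i))

-- Vertices of B_q (parameter n):
--   left l   : l ∈ L,   |L|   = 2 n^q
--   right0 j : j ∈ R_0, |R_0| = 2 n^q
--   righti i j : j ∈ R_{i+1} (i : Fin q encodes the index i+1 ∈ {1..q}), |R_{i+1}| = n^q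
data BVertex (n q : ℕ) : Set where
  left   : Fin (2 * n ^ q) → BVertex n q
  right0 : Fin (2 * n ^ q) → BVertex n q
  righti : Fin q → Fin (n ^ q) → BVertex n q

GVertex : (p n q : ℕ) → Set
GVertex p n q = Fin p × BVertex n q

numVertices : (p n q : ℕ) → ℕ
numVertices p n q = p * (2 * n ^ q + 2 * n ^ q + q * n ^ q)

-- An ordering: a bijection V(G_{p,q}) → {1,…,|V|} (encoded via Fin, position = toℕ + 1).
Ordering : (p n q : ℕ) → Set
Ordering p n q = GVertex p n q ⤖ Fin (numVertices p n q)

pos : ∀ {p n q} → Ordering p n q → GVertex p n q → ℕ
pos σ v = suc (toℕ (Bijection.to σ v))

-- L is cut into consecutive blocks of size 2 n^i (the partition 𝓛_i; consecutive blocks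
-- make the partitions nested as required), R_i into consecutive blocks of size n^i, and
-- the k-th block of 𝓛_i is paired with the k-th block of R_i.  For i = q this yields
-- all L–R_q pairs, i.e. edge class (i).
blockL : (n i : ℕ) → .{{NonZero n}} → ℕ → ℕ
blockL n i l = _/_ l (2 * n ^ i) {{m*n≢0 2 (n ^ i) {{_}} {{m^n≢0 n i}}}}

blockR : (n i : ℕ) → .{{NonZero n}} → ℕ → ℕ
blockR n i j = _/_ j (n ^ i) {{m^n≢0 n i}}

when≡ : ℕ → ℕ → ℕ → ℕ
when≡ x y a = if ⌊ x ≟ y ⌋ then a else 0

-- Cost of an ordering: Σ over edges e of min_{v ∈ e} σ(v).  All edges are of the form
-- {(c, left l), (c, r)}, so we sum over copies c, left vertices l, and right vertices.
cost : ∀ {p n q} → .{{NonZero n}} → Ordering p n q → ℕ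
cost {p} {n} {q} σ =
  sumFin p λ c → sumFin (2 * n ^ q) λ l →
    let m : GVertex p n q → ℕ
        m r = pos σ (c , left l) ⊓ pos σ r
    in
    m (c , right0 l)
    -- (i),(ii) edges L – R_i for i = 1..q  (i encoded as suc (toℕ i'))
    + sumFin q (λ i' → sumFin (n ^ q) λ j →
        when≡ (blockL n (suc (toℕ i')) (toℕ l)) (blockR n (suc (toℕ i')) (toℕ j))
              (m (c , righti i' j)))

-- Since min a b = #{k | k < a and k < b}, the cost of an ordering is the sum over
-- k of the number of edges with both ends after position k.  Every vertex of B_q has degree at
-- most 2n^q, and every vertex of L has degree exactly 1 + n + ⋯ + n^q, so G_{p,q} has 2n^q·T
-- edges, T = p(1 + n + ⋯ + n^q), and the first k positions meet at most 2n^q·k of them.  Hence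
-- the cost is at least Σ_{k<T} 2n^q(T − k) = n^q·T(T + 1), which exceeds p²n^{3q−1}(n + 2) as
-- T ≥ p(n^{q−1} + n^q).
-- For the upper bound, put R_q of all copies first, then L, then the other parts of R.  Charging
-- every L–R_q edge to its R_q end and every other edge to its L end bounds the cost by
-- 2n^q·Σ_{R_q} pos + (1 + n + ⋯ + n^{q−1})·Σ_L pos, and evaluating these arithmetic progressions
-- gives less than p²n^{3q−1}(n + 6) once n ≥ 7.
module Submission where

open import Defs
open import Data.Nat
  using (ℕ; zero; suc; _+_; _*_; _^_; _∸_; _⊓_; _≤_; _<_; _≟_; z≤n; s≤s; s≤s⁻¹; NonZero; >-nonZero)
open import Data.Nat.Properties
open import Data.Nat.DivMod using (_/_; m*n/n≡m; /-monoˡ-≤; m<n*o⇒m/o<n)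
open import Data.Nat.Tactic.RingSolver using (solve-∀; solve)
open import Data.List using (_∷_; [])
open import Data.Fin as Fin using (Fin; toℕ; fromℕ; inject₁; splitAt; remQuot; quotRem; combine; cast; _↑ˡ_; _↑ʳ_)
open import Data.Fin.Properties
  using ( toℕ<n; toℕ-inject₁; toℕ-fromℕ; combine-remQuot; +↔⊎; *↔×
        ; cast-involutive; toℕ-cast; toℕ-↑ˡ; toℕ-↑ʳ)
open import Data.Fin.Relation.Unary.Top using (view; ‵fromℕ; ‵inject₁; view-fromℕ; view-inject₁)
open import Data.Fin.Permutation using (Permutation)
open import Data.Product as Product using (_×_; _,_; proj₁; proj₂; uncurry; ∃)
open import Data.Product.Function.NonDependent.Propositional using (_×-↔_)
open import Data.Sum as Sum using (_⊎_; inj₁; inj₂; [_,_]′)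
open import Data.Sum.Function.Propositional using (_⊎-↔_)
open import Function using (_∘_)
open import Function.Bundles using (Inverse; _↔_; mk↔ₛ′)
open import Function.Properties.Inverse using (↔-refl; ↔-sym; ↔-trans; ↔⇒⤖)
open import Function.Properties.Bijection using (⤖⇒↔)
open import Relation.Nullary using (yes; no; contradiction)
open import Relation.Binary.PropositionalEquality using (_≡_; _≢_; refl; sym; trans; cong; cong₂; module ≡-Reasoning)
open import Algebra.Properties.CommutativeSemigroup +-commutativeSemigroup using (interchange)
open import Algebra.Properties.CommutativeSemigroup *-commutativeSemigroup using (x∙yz≈y∙xz)
open import Algebra.Properties.CommutativeMonoid.Sum +-0-commutativeMonoid using (sum; sum-permute)

-- Additive functionals and finite sums

record Additive {A : Set} (Φ : (A → ℕ) → ℕ) : Set where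
  field
    mono      : ∀ {f g} → (∀ x → f x ≤ g x) → Φ f ≤ Φ g
    distrib-+ : ∀ f g → Φ (λ x → f x + g x) ≡ Φ f + Φ g

  cong-≗ : ∀ {f g} → (∀ x → f x ≡ g x) → Φ f ≡ Φ g
  cong-≗ f≗g = ≤-antisym (mono (≤-reflexive ∘ f≗g)) (mono (≤-reflexive ∘ sym ∘ f≗g))

  zero-hom : Φ (λ _ → 0) ≡ 0
  zero-hom = +-cancelˡ-≡ (Φ (λ _ → 0)) _ _
    (trans (sym (distrib-+ (λ _ → 0) (λ _ → 0))) (sym (+-identityʳ _)))

  distribˡ-* : ∀ c f → Φ (λ x → c * f x) ≡ c * Φ f
  distribˡ-* zero    f = zero-hom
  distribˡ-* (suc c) f = trans (distrib-+ f (λ x → c * f x)) (cong (Φ f +_) (distribˡ-* c f))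

  distrib-sumFin : ∀ k (f : Fin k → A → ℕ) →
                   Φ (λ x → sumFin k (λ i → f i x)) ≡ sumFin k (λ i → Φ (f i))
  distrib-sumFin zero    f = zero-hom
  distrib-sumFin (suc k) f =
    trans (distrib-+ (f Fin.zero) _) (cong (Φ (f Fin.zero) +_) (distrib-sumFin k (f ∘ Fin.suc)))

module _ {A : Set} where

  app-additive : (x : A) → Additive (λ f → f x)
  app-additive x = record { mono = λ f≤g → f≤g x ; distrib-+ = λ _ _ → refl }

  +-additive : ∀ {Φ Ψ : (A → ℕ) → ℕ} → Additive Φ → Additive Ψ → Additive (λ f → Φ f + Ψ f)
  +-additive {Φ} {Ψ} Φ-add Ψ-add = record
    { mono      = λ f≤g → +-mono-≤ (Additive.mono Φ-add f≤g) (Additive.mono Ψ-add f≤g)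
    ; distrib-+ = λ f g → trans (cong₂ _+_ (Additive.distrib-+ Φ-add f g) (Additive.distrib-+ Ψ-add f g))
                                (interchange (Φ f) (Φ g) (Ψ f) (Ψ g))
    }

  sumFin-additive : ∀ k {Φ : Fin k → (A → ℕ) → ℕ} → (∀ i → Additive (Φ i)) →
                    Additive (λ f → sumFin k (λ i → Φ i f))
  sumFin-additive zero    _     = record { mono = λ _ → z≤n ; distrib-+ = λ _ _ → refl }
  sumFin-additive (suc k) Φ-add = +-additive (Φ-add Fin.zero) (sumFin-additive k (Φ-add ∘ Fin.suc))

module SumFin (k : ℕ) = Additive (sumFin-additive k app-additive)

sumℕ : ℕ → (ℕ → ℕ) → ℕ
sumℕ K f = sumFin K (f ∘ toℕ)

module Sumℕ (K : ℕ) = Additive (sumFin-additive K (app-additive ∘ toℕ))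

sumℕ-cong-< : ∀ K (f g : ℕ → ℕ) → (∀ k → k < K → f k ≡ g k) → sumℕ K f ≡ sumℕ K g
sumℕ-cong-< K f g f≡g = SumFin.cong-≗ K (λ i → f≡g (toℕ i) (toℕ<n i))

sumℕ-zero : ∀ K (f : ℕ → ℕ) → (∀ k → k < K → f k ≡ 0) → sumℕ K f ≡ 0
sumℕ-zero K f f≡0 = trans (sumℕ-cong-< K f (λ _ → 0) f≡0) (Sumℕ.zero-hom K)

sumFin-const : ∀ k c → sumFin k (λ _ → c) ≡ k * c
sumFin-const zero    c = refl
sumFin-const (suc k) c = cong (c +_) (sumFin-const k c)

sumFin-init-last : ∀ k (f : Fin (suc k) → ℕ) → sumFin (suc k) f ≡ sumFin k (f ∘ inject₁) + f (fromℕ k)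
sumFin-init-last zero    f = +-comm (f Fin.zero) 0
sumFin-init-last (suc k) f =
  trans (cong (f Fin.zero +_) (sumFin-init-last k (f ∘ Fin.suc))) (sym (+-assoc (f Fin.zero) _ _))

sumℕ-init-last : ∀ K f → sumℕ (suc K) f ≡ sumℕ K f + f K
sumℕ-init-last K f = trans (sumFin-init-last K (f ∘ toℕ))
  (cong₂ _+_ (SumFin.cong-≗ K (cong f ∘ toℕ-inject₁)) (cong f (toℕ-fromℕ K)))

sumℕ-last-two : ∀ k f → f k + f (suc k) ≤ sumℕ (suc (suc k)) f
sumℕ-last-two k f = begin
  f k + f (suc k)
    ≤⟨ +-monoˡ-≤ (f (suc k)) (≤-trans (m≤n+m (f k) _) (≤-reflexive (sym (sumℕ-init-last k f)))) ⟩
  sumℕ (suc k) f + f (suc k)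
    ≡⟨ sym (sumℕ-init-last (suc k) f) ⟩
  sumℕ (suc (suc k)) f       ∎
  where open ≤-Reasoning

sumℕ-++ : ∀ a b f → sumℕ (a + b) f ≡ sumℕ a f + sumℕ b (λ x → f (a + x))
sumℕ-++ zero    b f = refl
sumℕ-++ (suc a) b f = trans (cong (f 0 +_) (sumℕ-++ a b (f ∘ suc))) (sym (+-assoc (f 0) _ _))

sumFin-splitAt : ∀ a b (h : Fin a ⊎ Fin b → ℕ) →
                 sumFin (a + b) (h ∘ splitAt a) ≡ sumFin a (h ∘ inj₁) + sumFin b (h ∘ inj₂)
sumFin-splitAt zero    b h = refl
sumFin-splitAt (suc a) b h =
  trans (cong (h (inj₁ Fin.zero) +_) (sumFin-splitAt a b (h ∘ Sum.map₁ Fin.suc)))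
        (sym (+-assoc (h (inj₁ Fin.zero)) _ _))

sumFin-remQuot : ∀ a b (h : Fin a × Fin b → ℕ) →
                 sumFin (a * b) (h ∘ remQuot b) ≡ sumFin a (λ i → sumFin b (λ j → h (i , j)))
sumFin-remQuot zero    b h = refl
sumFin-remQuot (suc a) b h =
  -- remQuot {suc a} b unfolds to this case split on splitAt b.
  trans (sumFin-splitAt b (a * b) (h ∘ Product.swap ∘ [ (_, Fin.zero) , Product.map₂ Fin.suc ∘ quotRem b ]′))
        (cong (sumFin b (λ j → h (Fin.zero , j)) +_) (sumFin-remQuot a b (λ (i , j) → h (Fin.suc i , j))))

sumFin-combine : ∀ a b (g : ℕ → ℕ) →
                 sumFin a (λ i → sumFin b (λ j → g (toℕ (combine i j)))) ≡ sumℕ (a * b) g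
sumFin-combine a b g = sym (trans
  (SumFin.cong-≗ (a * b) (λ x → cong (g ∘ toℕ) (sym (combine-remQuot {a} b x))))
  (sumFin-remQuot a b (g ∘ toℕ ∘ uncurry combine)))

sumFin≡sum : ∀ k (f : Fin k → ℕ) → sumFin k f ≡ sum f
sumFin≡sum zero    f = refl
sumFin≡sum (suc k) f = cong (f Fin.zero +_) (sumFin≡sum k (f ∘ Fin.suc))

sumFin-permute : ∀ k (π : Permutation k k) (f : Fin k → ℕ) → sumFin k (f ∘ Inverse.to π) ≡ sumFin k f
sumFin-permute k π f = trans (sumFin≡sum k _) (trans (sym (sum-permute f π)) (sym (sumFin≡sum k f)))

sumℕ-countdown : ∀ T → 2 * sumℕ T (T ∸_) ≡ T * suc T
sumℕ-countdown zero    = refl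
sumℕ-countdown (suc T) = begin
  2 * (suc T + sumℕ T (T ∸_))   ≡⟨ *-distribˡ-+ 2 (suc T) _ ⟩
  2 * suc T + 2 * sumℕ T (T ∸_) ≡⟨ cong (2 * suc T +_) (sumℕ-countdown T) ⟩
  2 * suc T + T * suc T         ≡⟨ solve (T ∷ []) ⟩
  suc T * suc (suc T)           ∎
  where open ≡-Reasoning

sumℕ-arithmetic : ∀ N a → 2 * sumℕ N (λ x → suc (a + x)) ≡ N * (2 * a + suc N)
sumℕ-arithmetic zero    a = refl
sumℕ-arithmetic (suc N) a = begin
  2 * (suc (a + 0) + sumℕ N (λ x → suc (a + suc x)))
    ≡⟨ cong (λ s → 2 * (suc (a + 0) + s)) (Sumℕ.cong-≗ N (λ x → cong suc (+-suc a x))) ⟩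
  2 * (suc (a + 0) + sumℕ N (λ x → suc (suc a + x)))
    ≡⟨ *-distribˡ-+ 2 (suc (a + 0)) _ ⟩
  2 * suc (a + 0) + 2 * sumℕ N (λ x → suc (suc a + x))
    ≡⟨ cong (2 * suc (a + 0) +_) (sumℕ-arithmetic N (suc a)) ⟩
  2 * suc (a + 0) + N * (2 * suc a + suc N)
    ≡⟨ solve (N ∷ a ∷ []) ⟩
  suc N * (2 * a + suc (suc N)) ∎
  where open ≡-Reasoning

geometric-≤ : ∀ {d n} → suc d ≤ n → ∀ k → d * sumℕ (suc k) (n ^_) + 1 ≤ suc d * n ^ k
geometric-≤ {d} {n} d<n zero    = ≤-reflexive (solve (d ∷ []))
geometric-≤ {d} {n} d<n (suc k) = begin
  d * (1 + sumℕ (suc k) (λ t → n * n ^ t)) + 1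
    ≡⟨ cong (λ s → d * (1 + s) + 1) (Sumℕ.distribˡ-* (suc k) n (n ^_)) ⟩
  d * (1 + n * sumℕ (suc k) (n ^_)) + 1
    ≤⟨ step (geometric-≤ d<n k) ⟩
  suc d * (n * n ^ k) ∎
  where
  open ≤-Reasoning
  step : ∀ {S X} → d * S + 1 ≤ suc d * X → d * (1 + n * S) + 1 ≤ suc d * (n * X)
  step {S} {X} ih = begin
    d * (1 + n * S) + 1 ≡⟨ solve (d ∷ n ∷ S ∷ []) ⟩
    suc d + n * (d * S) ≤⟨ +-monoˡ-≤ _ d<n ⟩
    n + n * (d * S)     ≡⟨ solve (n ∷ d ∷ S ∷ []) ⟩
    n * (d * S + 1)     ≤⟨ *-monoʳ-≤ n ih ⟩
    n * (suc d * X)     ≡⟨ solve (n ∷ d ∷ X ∷ []) ⟩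
    suc d * (n * X)     ∎

-- The layer-cake bound

[_≤_] : ℕ → ℕ → ℕ
[ zero  ≤ _     ] = 1
[ suc _ ≤ zero  ] = 0
[ suc a ≤ suc b ] = [ a ≤ b ]

[≤]-⊓ : ∀ a b c → [ a ≤ b ] * [ a ≤ c ] ≡ [ a ≤ b ⊓ c ]
[≤]-⊓ zero    _       _       = refl
[≤]-⊓ (suc a) zero    _       = refl
[≤]-⊓ (suc a) (suc b) zero    = *-zeroʳ [ a ≤ b ]
[≤]-⊓ (suc a) (suc b) (suc c) = [≤]-⊓ a b c

sumℕ-[≤] : ∀ K a → sumℕ K (λ k → [ suc k ≤ a ]) ≤ a
sumℕ-[≤] zero    a       = z≤n
sumℕ-[≤] (suc K) zero    = ≤-reflexive (Sumℕ.zero-hom K)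
sumℕ-[≤] (suc K) (suc a) = s≤s (sumℕ-[≤] K a)

[≤]-cover : ∀ k a b → 1 ≤ ([ a ≤ k ] + [ b ≤ k ]) + [ suc k ≤ a ] * [ suc k ≤ b ]
[≤]-cover k       zero    b       = s≤s z≤n
[≤]-cover k       (suc a) zero    = ≤-trans (m≤n+m 1 [ suc a ≤ k ]) (m≤m+n _ _)
[≤]-cover zero    (suc a) (suc b) = s≤s z≤n
[≤]-cover (suc k) (suc a) (suc b) = [≤]-cover k a b

-- The k-th summand is at most the weight of the e with x e and y e both beyond k,
-- and these layers add up to min.
layer-cake : ∀ {A : Set} {Φ : (A → ℕ) → ℕ} → Additive Φ → (x y : A → ℕ) → ∀ K →
  sumℕ K (λ k → Φ (λ _ → 1) ∸ Φ (λ e → [ x e ≤ k ] + [ y e ≤ k ])) ≤ Φ (λ e → x e ⊓ y e)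
layer-cake {A} {Φ} Φ-add x y K = begin
  sumℕ K (λ k → Φ (λ _ → 1) ∸ Φ (touched k))
    ≤⟨ Sumℕ.mono K untouched-≥ ⟩
  sumℕ K (λ k → Φ (untouched k))
    ≡⟨ sym (distrib-sumFin K (untouched ∘ toℕ)) ⟩
  Φ (λ e → sumℕ K (λ k → untouched k e))
    ≡⟨ cong-≗ (λ e → Sumℕ.cong-≗ K (λ k → [≤]-⊓ (suc k) (x e) (y e))) ⟩
  Φ (λ e → sumℕ K (λ k → [ suc k ≤ x e ⊓ y e ]))
    ≤⟨ mono (λ e → sumℕ-[≤] K (x e ⊓ y e)) ⟩
  Φ (λ e → x e ⊓ y e) ∎
  where
  open ≤-Reasoning
  open Additive Φ-add
  touched untouched : ℕ → A → ℕ
  touched   k e = [ x e ≤ k ] + [ y e ≤ k ]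
  untouched k e = [ suc k ≤ x e ] * [ suc k ≤ y e ]
  untouched-≥ : ∀ k → Φ (λ _ → 1) ∸ Φ (touched k) ≤ Φ (untouched k)
  untouched-≥ k =
    m≤n+o⇒m∸n≤o _ _ (≤-trans (mono (λ e → [≤]-cover k (x e) (y e))) (≤-reflexive (distrib-+ _ _)))

-- Blocks of the partitions

when≡-refl : ∀ x a → when≡ x x a ≡ a
when≡-refl x a with x ≟ x
... | yes _  = refl
... | no x≢x = contradiction refl x≢x

when≡-≢ : ∀ {x y a} → x ≢ y → when≡ x y a ≡ 0
when≡-≢ {x} {y} x≢y with x ≟ y
... | yes x≡y = contradiction x≡y x≢y
... | no _    = refl

when≡-≤ : ∀ x y a → when≡ x y a ≤ a
when≡-≤ x y a with x ≟ y
... | yes _ = ≤-refl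
... | no _  = z≤n

when≡-* : ∀ x y a → when≡ x y a ≡ a * when≡ x y 1
when≡-* x y a with x ≟ y
... | yes _ = sym (*-identityʳ a)
... | no _  = sym (*-zeroʳ a)

when≡-mono : ∀ x y {a b} → a ≤ b → when≡ x y a ≤ when≡ x y b
when≡-mono x y a≤b with x ≟ y
... | yes _ = a≤b
... | no _  = z≤n

when≡-+ : ∀ x y a b → when≡ x y (a + b) ≡ when≡ x y a + when≡ x y b
when≡-+ x y a b with x ≟ y
... | yes _ = refl
... | no _  = refl

when≡-additive : ∀ {A : Set} x y (e : A) → Additive (λ f → when≡ x y (f e))
when≡-additive x y e = record
  { mono      = λ f≤g → when≡-mono x y (f≤g e)
  ; distrib-+ = λ f g → when≡-+ x y (f e) (g e)
  }

module _ {D : ℕ} .{{_ : NonZero D}} where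

  /-below : ∀ {j c} → j < c * D → j / D < c
  /-below = m<n*o⇒m/o<n

  /-above : ∀ {j c} → suc c * D ≤ j → suc c ≤ j / D
  /-above {j} {c} le = ≤-trans (≤-reflexive (sym (m*n/n≡m (suc c) D))) (/-monoˡ-≤ D le)

  /-inside : ∀ {c x} → x < D → (c * D + x) / D ≡ c
  /-inside {c} {x} x<D = ≤-antisym
    (s≤s⁻¹ (/-below (≤-trans (+-monoʳ-< (c * D) x<D) (≤-reflexive (+-comm (c * D) D)))))
    (≤-trans (≤-reflexive (sym (m*n/n≡m c D))) (/-monoˡ-≤ D (m≤m+n (c * D) x)))

  block-size : ∀ N c → suc c * D ≤ N → sumℕ N (λ j → when≡ c (j / D) 1) ≡ D
  block-size N c block≤N = begin
    sumℕ N f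
      ≡⟨ cong (λ N → sumℕ N f) N≡ ⟩
    sumℕ (c * D + (D + r)) f
      ≡⟨ sumℕ-++ (c * D) (D + r) f ⟩
    sumℕ (c * D) f + sumℕ (D + r) (λ x → f (c * D + x))
      ≡⟨ cong (sumℕ (c * D) f +_) (sumℕ-++ D r (λ x → f (c * D + x))) ⟩
    sumℕ (c * D) f + (sumℕ D (λ x → f (c * D + x)) + sumℕ r (λ x → f (c * D + (D + x))))
      ≡⟨ cong₂ _+_ before (cong₂ _+_ inside after) ⟩
    0 + (D + 0)
      ≡⟨ +-identityʳ D ⟩
    D ∎
    where
    open ≡-Reasoning
    f : ℕ → ℕ
    f j = when≡ c (j / D) 1
    r : ℕ
    r = N ∸ suc c * D
    N≡ : N ≡ c * D + (D + r)
    N≡ = trans (sym (m+[n∸m]≡n block≤N)) (trans (cong (_+ r) (+-comm D (c * D))) (+-assoc (c * D) D r))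
    before : sumℕ (c * D) f ≡ 0
    before = sumℕ-zero (c * D) f λ j j<cD → when≡-≢ λ c≡j/D → <-irrefl (sym c≡j/D) (/-below {c = c} j<cD)
    inside : sumℕ D (λ x → f (c * D + x)) ≡ D
    inside = trans (sumℕ-cong-< D (λ x → f (c * D + x)) (λ _ → 1)
                                (λ x x<D → trans (cong (λ z → when≡ c z 1) (/-inside x<D)) (when≡-refl c 1)))
                   (trans (sumFin-const D 1) (*-identityʳ D))
    after : sumℕ r (λ x → f (c * D + (D + x))) ≡ 0
    after = sumℕ-zero r (λ x → f (c * D + (D + x))) λ x _ →
      when≡-≢ λ c≡j/D → <-irrefl c≡j/D (/-above {c = c} (block≤ x))
      where
      block≤ : ∀ x → suc c * D ≤ c * D + (D + x)
      block≤ x = ≤-trans (≤-reflexive (+-comm D (c * D))) (+-monoʳ-≤ (c * D) (m≤m+n D x))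

-- Degrees in B_q

module _ (n : ℕ) .{{_ : NonZero n}} where

  -- Level t ≥ 1 is R_t; level 0 stands for the perfect matching with R_0.
  levelDegree : ℕ → ℕ → ℕ → ℕ
  levelDegree q zero    _ = 1
  levelDegree q (suc t) l = sumℕ (n ^ q) (λ j → when≡ (blockL n (suc t) l) (blockR n (suc t) j) 1)

  degree : ℕ → ℕ → ℕ
  degree q l = sumℕ (suc q) (λ t → levelDegree q t l)

  block-fits : ∀ {s q l} → s ≤ q → l < 2 * n ^ q → suc (blockL n s l) * n ^ s ≤ n ^ q
  block-fits {s} {q} {l} s≤q l<2m = begin
    suc (blockL n s l) * n ^ s
      ≤⟨ *-monoˡ-≤ (n ^ s) (m<n*o⇒m/o<n {n = n ^ d} {{m*n≢0 2 (n ^ s) {{_}} {{m^n≢0 n s}}}} l<) ⟩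
    n ^ d * n ^ s
      ≡⟨ n^q≡ ⟩
    n ^ q ∎
    where
    open ≤-Reasoning
    d : ℕ
    d = q ∸ s
    n^q≡ : n ^ d * n ^ s ≡ n ^ q
    n^q≡ = trans (sym (^-distribˡ-+-* n d s)) (cong (n ^_) (m∸n+n≡m s≤q))
    l< : l < n ^ d * (2 * n ^ s)
    l< = ≤-trans l<2m (≤-reflexive (trans (cong (2 *_) (sym n^q≡)) (x∙yz≈y∙xz 2 (n ^ d) (n ^ s))))

  levelDegree-≡ : ∀ {q t l} → t ≤ q → l < 2 * n ^ q → levelDegree q t l ≡ n ^ t
  levelDegree-≡ {t = zero}        _   _    = refl
  levelDegree-≡ {q} {suc t} {l} t<q l<2m =
    block-size {{m^n≢0 n (suc t)}} (n ^ q) (blockL n (suc t) l) (block-fits t<q l<2m)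

  degree-≡ : ∀ {q l} → l < 2 * n ^ q → degree q l ≡ sumℕ (suc q) (n ^_)
  degree-≡ {q} l<2m = sumℕ-cong-< (suc q) _ _ (λ t t≤q → levelDegree-≡ (s≤s⁻¹ t≤q) l<2m)

  degree-≤ : 2 ≤ n → ∀ {q l} → l < 2 * n ^ q → degree q l ≤ 2 * n ^ q
  degree-≤ 2≤n {q} {l} l<2m = begin
    degree q l  ≡⟨ degree-≡ {q} l<2m ⟩
    G           ≤⟨ m≤n*m G 1 ⟩
    1 * G       ≤⟨ m≤m+n (1 * G) 1 ⟩
    1 * G + 1   ≤⟨ geometric-≤ 2≤n q ⟩
    2 * n ^ q   ∎
    where
    open ≤-Reasoning
    G : ℕ
    G = sumℕ (suc q) (n ^_)

⊎↔+ : ∀ {a b} → (Fin a ⊎ Fin b) ↔ Fin (a + b)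
⊎↔+ = ↔-sym +↔⊎

×↔* : ∀ {a b} → (Fin a × Fin b) ↔ Fin (a * b)
×↔* = ↔-sym *↔×

infixr 1 _⊎-↔+_
_⊎-↔+_ : ∀ {A B : Set} {a b} → A ↔ Fin a → B ↔ Fin b → (A ⊎ B) ↔ Fin (a + b)
f ⊎-↔+ g = ↔-trans (f ⊎-↔ g) ⊎↔+

module _ (p n q : ℕ) where

  private
    m : ℕ
    m = n ^ q

  vertexSum : (GVertex p n q → ℕ) → ℕ
  vertexSum g = sumFin p λ c →
    (sumFin (2 * m) (λ l → g (c , left l)) + sumFin (2 * m) (λ l → g (c , right0 l)))
    + sumFin q (λ i → sumFin m (λ j → g (c , righti i j)))

  bVertex↔ : BVertex n q ↔ ((Fin (2 * m) ⊎ Fin (2 * m)) ⊎ (Fin q × Fin m))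
  bVertex↔ = mk↔ₛ′ to from to∘from from∘to
    where
    to : BVertex n q → (Fin (2 * m) ⊎ Fin (2 * m)) ⊎ (Fin q × Fin m)
    to (left l)     = inj₁ (inj₁ l)
    to (right0 l)   = inj₁ (inj₂ l)
    to (righti i j) = inj₂ (i , j)
    from : (Fin (2 * m) ⊎ Fin (2 * m)) ⊎ (Fin q × Fin m) → BVertex n q
    from (inj₁ (inj₁ l)) = left l
    from (inj₁ (inj₂ l)) = right0 l
    from (inj₂ (i , j))  = righti i j
    to∘from : ∀ x → to (from x) ≡ x
    to∘from (inj₁ (inj₁ _)) = refl
    to∘from (inj₁ (inj₂ _)) = refl
    to∘from (inj₂ _)        = refl
    from∘to : ∀ v → from (to v) ≡ v
    from∘to (left _)     = refl
    from∘to (right0 _)   = refl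
    from∘to (righti _ _) = refl

  vertexEnum : GVertex p n q ↔ Fin (numVertices p n q)
  vertexEnum = ↔-trans (↔-refl ×-↔ ↔-trans bVertex↔ (⊎↔+ ⊎-↔+ ×↔*)) ×↔*

  vertexSum-enum : ∀ g → sumFin (numVertices p n q) (g ∘ Inverse.from vertexEnum) ≡ vertexSum g
  vertexSum-enum g = begin
    sumFin (p * X) (g ∘ Inverse.from vertexEnum)
      ≡⟨ sumFin-remQuot p X (λ (c , y) → g (c , decodeS (splitAt (2 * m + 2 * m) y))) ⟩
    sumFin p (λ c → sumFin X (λ y → g (c , decodeS (splitAt (2 * m + 2 * m) y))))
      ≡⟨ SumFin.cong-≗ p (λ c →
           trans (sumFin-splitAt (2 * m + 2 * m) (q * m) (λ s → g (c , decodeS s)))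
                 (cong₂ _+_ (sumFin-splitAt (2 * m) (2 * m) (λ s → g (c , decode (inj₁ s))))
                            (sumFin-remQuot q m (λ ij → g (c , decode (inj₂ ij)))))) ⟩
    vertexSum g ∎
    where
    open ≡-Reasoning
    X : ℕ
    X = 2 * m + 2 * m + q * m
    decode : (Fin (2 * m) ⊎ Fin (2 * m)) ⊎ (Fin q × Fin m) → BVertex n q
    decode = Inverse.from bVertex↔
    decodeS : Fin (2 * m + 2 * m) ⊎ Fin (q * m) → BVertex n q
    decodeS s = decode (Sum.map (splitAt (2 * m)) (remQuot m) s)

  vertexSum-pos : (σ : Ordering p n q) (g : ℕ → ℕ) → vertexSum (g ∘ pos σ) ≡ sumℕ (numVertices p n q) (g ∘ suc)
  vertexSum-pos σ g = trans (sym (vertexSum-enum (g ∘ pos σ)))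
    (sumFin-permute (numVertices p n q) (↔-trans (↔-sym vertexEnum) (⤖⇒↔ σ)) (g ∘ suc ∘ toℕ))

  prefix-size : (σ : Ordering p n q) → ∀ k → vertexSum (λ v → [ pos σ v ≤ k ]) ≤ k
  prefix-size σ k = ≤-trans (≤-reflexive (vertexSum-pos σ (λ x → [ x ≤ k ]))) (sumℕ-[≤] (numVertices p n q) k)

-- Sums over the edges, and the lower bound

module _ (p n q : ℕ) .{{_ : NonZero n}} where

  private
    m : ℕ
    m = n ^ q

  edgeSumAt : Fin p → Fin (2 * m) → (GVertex p n q × GVertex p n q → ℕ) → ℕ
  edgeSumAt c l h = h ((c , left l) , (c , right0 l))
    + sumFin q (λ i → sumFin m λ j →
        when≡ (blockL n (suc (toℕ i)) (toℕ l)) (blockR n (suc (toℕ i)) (toℕ j))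
              (h ((c , left l) , (c , righti i j))))

  edgeSum : (GVertex p n q × GVertex p n q → ℕ) → ℕ
  edgeSum h = sumFin p λ c → sumFin (2 * m) λ l → edgeSumAt c l h

  cost≡edgeSum : (σ : Ordering p n q) → cost σ ≡ edgeSum (λ (u , v) → pos σ u ⊓ pos σ v)
  cost≡edgeSum σ = refl

  edgeSumAt-additive : ∀ c l → Additive (edgeSumAt c l)
  edgeSumAt-additive c l =
    +-additive (app-additive _) (sumFin-additive q λ i → sumFin-additive m λ j → when≡-additive _ _ _)

  edgeSum-additive : Additive edgeSum
  edgeSum-additive = sumFin-additive p λ c → sumFin-additive (2 * m) (edgeSumAt-additive c)

  edgeSumAt-const : ∀ c l a → edgeSumAt c l (λ _ → a) ≡ a * degree n q (toℕ l)
  edgeSumAt-const c l a = trans (cong-≗ (λ _ → sym (*-identityʳ a))) (distribˡ-* a (λ _ → 1))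
    where open Additive (edgeSumAt-additive c l)

  edgeSum-count : edgeSum (λ _ → 1) ≡ 2 * m * (p * sumℕ (suc q) (n ^_))
  edgeSum-count = begin
    edgeSum (λ _ → 1)
      ≡⟨ SumFin.cong-≗ p (λ _ → SumFin.cong-≗ (2 * m) (λ l → degree-≡ n {q} (toℕ<n l))) ⟩
    sumFin p (λ _ → sumFin (2 * m) (λ _ → G))
      ≡⟨ trans (sumFin-const p _) (cong (p *_) (sumFin-const (2 * m) G)) ⟩
    p * (2 * m * G)
      ≡⟨ x∙yz≈y∙xz p (2 * m) G ⟩
    2 * m * (p * G) ∎
    where
    open ≡-Reasoning
    G : ℕ
    G = sumℕ (suc q) (n ^_)

  edgeSumAt-from-L : 2 ≤ n → ∀ f c →
    sumFin (2 * m) (λ l → edgeSumAt c l (f ∘ proj₁)) ≤ 2 * m * sumFin (2 * m) (λ l → f (c , left l))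
  edgeSumAt-from-L 2≤n f c = begin
    sumFin (2 * m) (λ l → edgeSumAt c l (λ _ → f (c , left l)))
      ≤⟨ SumFin.mono (2 * m) (λ l → ≤-trans (≤-reflexive (edgeSumAt-const c l _))
                                            (*-monoʳ-≤ (f (c , left l)) (degree-≤ n 2≤n {q} (toℕ<n l)))) ⟩
    sumFin (2 * m) (λ l → f (c , left l) * (2 * m))
      ≡⟨ trans (SumFin.cong-≗ (2 * m) (λ l → *-comm (f (c , left l)) (2 * m)))
               (SumFin.distribˡ-* (2 * m) (2 * m) _) ⟩
    2 * m * sumFin (2 * m) (λ l → f (c , left l)) ∎
    where open ≤-Reasoning

  edgeSumAt-into-R : ∀ f c →
    sumFin (2 * m) (λ l → edgeSumAt c l (f ∘ proj₂))
    ≤ 2 * m * (sumFin (2 * m) (λ l → f (c , right0 l)) + sumFin q (λ i → sumFin m (λ j → f (c , righti i j))))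
  edgeSumAt-into-R f c = begin
    sumFin (2 * m) (λ l → edgeSumAt c l (f ∘ proj₂))
      ≤⟨ SumFin.mono (2 * m) (λ l → +-monoʳ-≤ (f (c , right0 l))
           (SumFin.mono q (λ i → SumFin.mono m (λ j → when≡-≤ _ _ (f (c , righti i j)))))) ⟩
    sumFin (2 * m) (λ l → f (c , right0 l) + R)
      ≡⟨ trans (SumFin.distrib-+ (2 * m) _ _) (cong (R₀ +_) (sumFin-const (2 * m) R)) ⟩
    R₀ + 2 * m * R
      ≤⟨ +-monoˡ-≤ (2 * m * R) (m≤n*m R₀ (2 * m) {{m*n≢0 2 m {{_}} {{m^n≢0 n q}}}}) ⟩
    2 * m * R₀ + 2 * m * R
      ≡⟨ sym (*-distribˡ-+ (2 * m) R₀ R) ⟩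
    2 * m * (R₀ + R) ∎
    where
    open ≤-Reasoning
    R₀ R : ℕ
    R₀ = sumFin (2 * m) (λ l → f (c , right0 l))
    R  = sumFin q (λ i → sumFin m (λ j → f (c , righti i j)))

  edgeSum-endpoints : 2 ≤ n → ∀ f → edgeSum (λ (u , v) → f u + f v) ≤ 2 * m * vertexSum p n q f
  edgeSum-endpoints 2≤n f = begin
    edgeSum (λ (u , v) → f u + f v)
      ≡⟨ trans (distrib-+ (f ∘ proj₁) (f ∘ proj₂)) (sym (SumFin.distrib-+ p _ _)) ⟩
    sumFin p (λ c → sumFin (2 * m) (λ l → edgeSumAt c l (f ∘ proj₁))
                    + sumFin (2 * m) (λ l → edgeSumAt c l (f ∘ proj₂)))
      ≤⟨ SumFin.mono p (λ c → +-mono-≤ (edgeSumAt-from-L 2≤n f c) (edgeSumAt-into-R f c)) ⟩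
    sumFin p (λ c → 2 * m * L c + 2 * m * (R₀ c + R c))
      ≡⟨ SumFin.cong-≗ p (λ c → trans (sym (*-distribˡ-+ (2 * m) (L c) _))
                                     (cong (2 * m *_) (sym (+-assoc (L c) _ _)))) ⟩
    sumFin p (λ c → 2 * m * ((L c + R₀ c) + R c))
      ≡⟨ SumFin.distribˡ-* p (2 * m) _ ⟩
    2 * m * vertexSum p n q f ∎
    where
    open ≤-Reasoning
    open Additive edgeSum-additive
    L R₀ R : Fin p → ℕ
    L  c = sumFin (2 * m) (λ l → f (c , left l))
    R₀ c = sumFin (2 * m) (λ l → f (c , right0 l))
    R  c = sumFin q (λ i → sumFin m (λ j → f (c , righti i j)))

  cost-≥ : 2 ≤ n → (σ : Ordering p n q) → let T = p * sumℕ (suc q) (n ^_) in m * (T * suc T) ≤ cost σ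
  cost-≥ 2≤n σ = begin
    m * (T * suc T)
      ≡⟨ cong (m *_) (sym (sumℕ-countdown T)) ⟩
    m * (2 * sumℕ T (T ∸_))
      ≡⟨ trans (x∙yz≈y∙xz m 2 _) (sym (*-assoc 2 m _)) ⟩
    2 * m * sumℕ T (T ∸_)
      ≡⟨ sym (Sumℕ.distribˡ-* T (2 * m) (T ∸_)) ⟩
    sumℕ T (λ k → 2 * m * (T ∸ k))
      ≡⟨ Sumℕ.cong-≗ T (λ k → *-distribˡ-∸ (2 * m) T k) ⟩
    sumℕ T (λ k → 2 * m * T ∸ 2 * m * k)
      ≤⟨ Sumℕ.mono T (λ k → ∸-mono (≤-reflexive (sym edgeSum-count)) (touching-≤ k)) ⟩
    sumℕ T (λ k → edgeSum (λ _ → 1) ∸ edgeSum (touching k))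
      ≤⟨ layer-cake edgeSum-additive (pos σ ∘ proj₁) (pos σ ∘ proj₂) T ⟩
    edgeSum (λ (u , v) → pos σ u ⊓ pos σ v)
      ≡⟨ sym (cost≡edgeSum σ) ⟩
    cost σ ∎
    where
    open ≤-Reasoning
    T : ℕ
    T = p * sumℕ (suc q) (n ^_)
    touching : ℕ → GVertex p n q × GVertex p n q → ℕ
    touching k (u , v) = [ pos σ u ≤ k ] + [ pos σ v ≤ k ]
    touching-≤ : ∀ k → edgeSum (touching k) ≤ 2 * m * k
    touching-≤ k =
      ≤-trans (edgeSum-endpoints 2≤n (λ v → [ pos σ v ≤ k ])) (*-monoʳ-≤ (2 * m) (prefix-size p n q σ k))

-- Arithmetic estimates

p²n^[3q∸1] : ∀ p n q₀ → p ^ 2 * n ^ (3 * suc q₀ ∸ 1) ≡ p * p * (n ^ q₀ * (n ^ suc q₀ * n ^ suc q₀))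
p²n^[3q∸1] p n q₀ = cong₂ _*_ (cong (p *_) (*-identityʳ p)) (begin
  n ^ (q₀ + (suc q₀ + (suc q₀ + 0)))
    ≡⟨ ^-distribˡ-+-* n q₀ _ ⟩
  n ^ q₀ * n ^ (suc q₀ + (suc q₀ + 0))
    ≡⟨ cong (n ^ q₀ *_) (^-distribˡ-+-* n (suc q₀) _) ⟩
  n ^ q₀ * (n ^ suc q₀ * n ^ (suc q₀ + 0))
    ≡⟨ cong (λ e → n ^ q₀ * (n ^ suc q₀ * n ^ e)) (+-identityʳ (suc q₀)) ⟩
  n ^ q₀ * (n ^ suc q₀ * n ^ suc q₀) ∎)
  where open ≡-Reasoning

lower-arithmetic : ∀ {p n X} → 1 ≤ p → 1 ≤ n → 1 ≤ X →
  p * p * (X * (n * X * (n * X))) * (n + 2) < n * X * (p * (X + n * X) * suc (p * (X + n * X)))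
lower-arithmetic {p} {n} {X} 1≤p 1≤n 1≤X = begin-strict
  p * p * (X * (n * X * (n * X))) * (n + 2)
    <⟨ m<m+n _ (≤-trans 1≤p²nX³ (m≤m+n _ _)) ⟩
  p * p * (X * (n * X * (n * X))) * (n + 2) + (p * p * n * (X * X * X) + n * X * (p * (X + n * X)))
    ≡⟨ solve (p ∷ n ∷ X ∷ []) ⟩
  n * X * (p * (X + n * X) * suc (p * (X + n * X))) ∎
  where
  open ≤-Reasoning
  1≤p²nX³ : 1 ≤ p * p * n * (X * X * X)
  1≤p²nX³ = *-mono-≤ (*-mono-≤ (*-mono-≤ 1≤p 1≤p) 1≤n) (*-mono-≤ (*-mono-≤ 1≤X 1≤X) 1≤X)

upper-arithmetic-core : ∀ {s X m P} → 6 * s + 1 ≤ 7 * X → 1 ≤ X → m ≤ P → 7 ≤ P →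
                        s * (4 * P + 1) + m < 6 * (P * X)
upper-arithmetic-core {s} {X} {m} {P} 6s<7X 1≤X m≤P 7≤P = *-cancelˡ-< 6 _ _ (begin-strict
  6 * (s * (4 * P + 1) + m)
    <⟨ m<m+n _ (s≤s z≤n) ⟩
  6 * (s * (4 * P + 1) + m) + (1 + 4 * P)
    ≡⟨ solve (s ∷ m ∷ P ∷ []) ⟩
  (6 * s + 1) * (4 * P + 1) + 6 * m
    ≤⟨ +-monoˡ-≤ (6 * m) (*-monoˡ-≤ (4 * P + 1) 6s<7X) ⟩
  7 * X * (4 * P + 1) + 6 * m
    ≡⟨ solve (X ∷ P ∷ m ∷ []) ⟩
  28 * (P * X) + 7 * X + 6 * m
    ≤⟨ +-mono-≤ (+-monoʳ-≤ (28 * (P * X)) (*-monoˡ-≤ X 7≤P)) (*-monoʳ-≤ 6 m≤PX) ⟩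
  28 * (P * X) + P * X + 6 * (P * X)
    ≤⟨ m≤m+n _ (P * X) ⟩
  28 * (P * X) + P * X + 6 * (P * X) + P * X
    ≡⟨ solve (P ∷ X ∷ []) ⟩
  6 * (6 * (P * X)) ∎)
  where
  open ≤-Reasoning
  m≤PX : m ≤ P * X
  m≤PX = ≤-trans m≤P (m≤m*n P X {{>-nonZero 1≤X}})

upper-arithmetic : ∀ {p n X s} → 1 ≤ p → 7 ≤ n → 1 ≤ X → 6 * s + 1 ≤ 7 * X →
  s * (p * (2 * (n * X)) * (2 * (p * (n * X)) + suc (p * (2 * (n * X)))))
  + 2 * (n * X) * (p * (n * X) * (2 * 0 + suc (p * (n * X))))
  < 2 * (p * p * (X * (n * X * (n * X))) * (n + 6))
upper-arithmetic {p} {n} {X} {s} 1≤p 7≤n 1≤X 6s<7X = begin-strict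
  s * (p * (2 * (n * X)) * (2 * (p * (n * X)) + suc (p * (2 * (n * X)))))
  + 2 * (n * X) * (p * (n * X) * (2 * 0 + suc (p * (n * X))))
    ≡⟨ solve (s ∷ p ∷ n ∷ X ∷ []) ⟩
  2 * (p * (n * X)) * (s * (4 * (p * (n * X)) + 1) + n * X + n * X * (p * (n * X)))
    <⟨ *-monoʳ-< (2 * (p * (n * X))) {{>-nonZero 0<2P}} (+-monoˡ-< _ (upper-arithmetic-core {s} 6s<7X 1≤X m≤P 7≤P)) ⟩
  2 * (p * (n * X)) * (6 * (p * (n * X) * X) + n * X * (p * (n * X)))
    ≡⟨ solve (p ∷ n ∷ X ∷ []) ⟩
  2 * (p * p * (X * (n * X * (n * X))) * (n + 6)) ∎
  where
  open ≤-Reasoning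
  m≤P : n * X ≤ p * (n * X)
  m≤P = m≤n*m (n * X) p {{>-nonZero 1≤p}}
  7≤P : 7 ≤ p * (n * X)
  7≤P = ≤-trans (*-mono-≤ 7≤n 1≤X) m≤P
  0<2P : 0 < 2 * (p * (n * X))
  0<2P = ≤-trans (≤-trans (s≤s z≤n) 7≤P) (m≤n*m (p * (n * X)) 2)

-- The two bounds

cast↔ : ∀ {a b} → a ≡ b → Fin a ↔ Fin b
cast↔ a≡b =
  mk↔ₛ′ (cast a≡b) (cast (sym a≡b)) (cast-involutive a≡b (sym a≡b)) (cast-involutive (sym a≡b) a≡b)

module _ (p n q₀ : ℕ) .{{_ : NonZero n}} where

  private
    q m : ℕ
    q = suc q₀
    m = n ^ q

  edgeSumAt-cost-≤ : (σ : Ordering p n q) → ∀ c l →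
    edgeSumAt p n q c l (λ (u , v) → pos σ u ⊓ pos σ v)
    ≤ sumℕ q (n ^_) * pos σ (c , left l) + sumFin m (λ j → pos σ (c , righti (fromℕ q₀) j))
  edgeSumAt-cost-≤ σ c l = begin
    a ⊓ pos σ (c , right0 l) + sumFin q G
      ≡⟨ cong (a ⊓ pos σ (c , right0 l) +_) (sumFin-init-last q₀ G) ⟩
    a ⊓ pos σ (c , right0 l) + (sumFin q₀ (G ∘ inject₁) + G (fromℕ q₀))
      ≤⟨ +-mono-≤ (m⊓n≤m a (pos σ (c , right0 l))) (+-mono-≤ lower-levels top-level) ⟩
    a + (sumℕ q₀ (λ t → a * n ^ suc t) + B)
      ≡⟨ cong (λ x → a + (x + B)) (Sumℕ.distribˡ-* q₀ a (λ t → n ^ suc t)) ⟩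
    a + (a * sumℕ q₀ (λ t → n ^ suc t) + B)
      ≡⟨ regroup a _ B ⟩
    sumℕ q (n ^_) * a + B ∎
    where
    open ≤-Reasoning
    a B : ℕ
    a = pos σ (c , left l)
    B = sumFin m (λ j → pos σ (c , righti (fromℕ q₀) j))
    regroup : ∀ x y z → x + (x * y + z) ≡ (1 + y) * x + z
    regroup = solve-∀
    level : Fin q → ℕ
    level i = suc (toℕ i)
    G : Fin q → ℕ
    G i = sumFin m (λ j → when≡ (blockL n (level i) (toℕ l)) (blockR n (level i) (toℕ j)) (a ⊓ pos σ (c , righti i j)))
    lower-levels : sumFin q₀ (G ∘ inject₁) ≤ sumℕ q₀ (λ t → a * n ^ suc t)
    lower-levels = SumFin.mono q₀ λ i → begin
      G (inject₁ i)
        ≤⟨ SumFin.mono m (λ j → when≡-mono _ _ (m⊓n≤m a _)) ⟩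
      sumFin m (λ j → when≡ (blockL n (level (inject₁ i)) (toℕ l)) (blockR n (level (inject₁ i)) (toℕ j)) a)
        ≡⟨ trans (SumFin.cong-≗ m (λ j → when≡-* _ _ a)) (SumFin.distribˡ-* m a _) ⟩
      a * levelDegree n q (level (inject₁ i)) (toℕ l)
        ≡⟨ cong (a *_) (levelDegree-≡ n (toℕ<n (inject₁ i)) (toℕ<n l)) ⟩
      a * n ^ level (inject₁ i)
        ≡⟨ cong (λ t → a * n ^ suc t) (toℕ-inject₁ i) ⟩
      a * n ^ suc (toℕ i) ∎
    top-level : G (fromℕ q₀) ≤ B
    top-level = SumFin.mono m (λ j → ≤-trans (when≡-≤ _ _ _) (m⊓n≤n a _))

  cost-≤ : (σ : Ordering p n q) →
    cost σ ≤ sumℕ q (n ^_) * sumFin p (λ c → sumFin (2 * m) (λ l → pos σ (c , left l)))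
             + 2 * m * sumFin p (λ c → sumFin m (λ j → pos σ (c , righti (fromℕ q₀) j)))
  cost-≤ σ = begin
    cost σ
      ≤⟨ SumFin.mono p (λ c → SumFin.mono (2 * m) (edgeSumAt-cost-≤ σ c)) ⟩
    sumFin p (λ c → sumFin (2 * m) (λ l → s * a c l + B c))
      ≡⟨ SumFin.cong-≗ p (λ c → trans (SumFin.distrib-+ (2 * m) _ _)
                                     (cong₂ _+_ (SumFin.distribˡ-* (2 * m) s (a c)) (sumFin-const (2 * m) (B c)))) ⟩
    sumFin p (λ c → s * sumFin (2 * m) (a c) + 2 * m * B c)
      ≡⟨ trans (SumFin.distrib-+ p _ _) (cong₂ _+_ (SumFin.distribˡ-* p s _) (SumFin.distribˡ-* p (2 * m) B)) ⟩
    s * sumFin p (λ c → sumFin (2 * m) (a c)) + 2 * m * sumFin p B ∎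
    where
    open ≤-Reasoning
    s : ℕ
    s = sumℕ q (n ^_)
    a : Fin p → Fin (2 * m) → ℕ
    a c l = pos σ (c , left l)
    B : Fin p → ℕ
    B c = sumFin m (λ j → pos σ (c , righti (fromℕ q₀) j))

  Layout : Set
  Layout = (Fin p × Fin m) ⊎ (Fin p × Fin (2 * m)) ⊎ (Fin p × Fin (2 * m)) ⊎ (Fin p × (Fin q₀ × Fin m))

  layout : GVertex p n q → Layout
  layout (c , left l)     = inj₂ (inj₁ (c , l))
  layout (c , right0 l)   = inj₂ (inj₂ (inj₁ (c , l)))
  layout (c , righti i j) with view i
  ... | ‵fromℕ     = inj₁ (c , j)
  ... | ‵inject₁ k = inj₂ (inj₂ (inj₂ (c , k , j)))

  unlayout : Layout → GVertex p n q
  unlayout (inj₁ (c , j))                   = c , righti (fromℕ q₀) j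
  unlayout (inj₂ (inj₁ (c , l)))            = c , left l
  unlayout (inj₂ (inj₂ (inj₁ (c , l))))     = c , right0 l
  unlayout (inj₂ (inj₂ (inj₂ (c , k , j)))) = c , righti (inject₁ k) j

  layout-top : ∀ c j → layout (c , righti (fromℕ q₀) j) ≡ inj₁ (c , j)
  layout-top c j rewrite view-fromℕ q₀ = refl

  layout↔ : GVertex p n q ↔ Layout
  layout↔ = mk↔ₛ′ layout unlayout layout∘unlayout unlayout∘layout
    where
    layout∘unlayout : ∀ x → layout (unlayout x) ≡ x
    layout∘unlayout (inj₁ (c , j))                   = layout-top c j
    layout∘unlayout (inj₂ (inj₁ _))                  = refl
    layout∘unlayout (inj₂ (inj₂ (inj₁ _)))           = refl
    layout∘unlayout (inj₂ (inj₂ (inj₂ (c , k , j)))) rewrite view-inject₁ k = refl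
    unlayout∘layout : ∀ v → unlayout (layout v) ≡ v
    unlayout∘layout (c , left _)     = refl
    unlayout∘layout (c , right0 _)   = refl
    unlayout∘layout (c , righti i j) with view i
    ... | ‵fromℕ     = refl
    ... | ‵inject₁ k = refl

  layoutSize : ℕ
  layoutSize = p * m + (p * (2 * m) + (p * (2 * m) + p * (q₀ * m)))

  layout-enum : Layout ↔ Fin layoutSize
  layout-enum = ×↔* ⊎-↔+ ×↔* ⊎-↔+ ×↔* ⊎-↔+ ↔-trans (↔-refl ×-↔ ×↔*) ×↔*

  layoutSize≡ : layoutSize ≡ numVertices p n q
  layoutSize≡ = sizes p m q₀
    where
    sizes : ∀ p m q₀ → p * m + (p * (2 * m) + (p * (2 * m) + p * (q₀ * m))) ≡ p * (2 * m + 2 * m + suc q₀ * m)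
    sizes = solve-∀

  σ₀ : Ordering p n q
  σ₀ = ↔⇒⤖ (↔-trans layout↔ (↔-trans layout-enum (cast↔ layoutSize≡)))

  pos-left : ∀ c l → pos σ₀ (c , left l) ≡ suc (p * m + toℕ (combine c l))
  pos-left c l = cong suc (begin
    toℕ (cast layoutSize≡ (p * m ↑ʳ (combine c l ↑ˡ _))) ≡⟨ toℕ-cast layoutSize≡ _ ⟩
    toℕ (p * m ↑ʳ (combine c l ↑ˡ _))                   ≡⟨ toℕ-↑ʳ (p * m) _ ⟩
    p * m + toℕ (combine c l ↑ˡ _)                      ≡⟨ cong (p * m +_) (toℕ-↑ˡ (combine c l) _) ⟩
    p * m + toℕ (combine c l)                           ∎)
    where open ≡-Reasoning

  pos-top : ∀ c j → pos σ₀ (c , righti (fromℕ q₀) j) ≡ suc (toℕ (combine c j))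
  pos-top c j rewrite layout-top c j = cong suc (trans (toℕ-cast layoutSize≡ _) (toℕ-↑ˡ (combine c j) _))

  sum-pos-left : 2 * sumFin p (λ c → sumFin (2 * m) (λ l → pos σ₀ (c , left l)))
                 ≡ p * (2 * m) * (2 * (p * m) + suc (p * (2 * m)))
  sum-pos-left = trans (cong (2 *_) (trans (SumFin.cong-≗ p (λ c → SumFin.cong-≗ (2 * m) (pos-left c)))
                                           (sumFin-combine p (2 * m) (λ x → suc (p * m + x)))))
                       (sumℕ-arithmetic (p * (2 * m)) (p * m))

  sum-pos-top : 2 * sumFin p (λ c → sumFin m (λ j → pos σ₀ (c , righti (fromℕ q₀) j)))
                ≡ p * m * (2 * 0 + suc (p * m))
  sum-pos-top = trans (cong (2 *_) (trans (SumFin.cong-≗ p (λ c → SumFin.cong-≗ m (pos-top c)))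
                                          (sumFin-combine p m suc)))
                      (sumℕ-arithmetic (p * m) 0)

  lower-bound : 7 ≤ n → 1 ≤ p → (σ : Ordering p n q) → p ^ 2 * n ^ (3 * q ∸ 1) * (n + 2) < cost σ
  lower-bound 7≤n 1≤p σ = begin-strict
    p ^ 2 * n ^ (3 * q ∸ 1) * (n + 2)  ≡⟨ cong (_* (n + 2)) (p²n^[3q∸1] p n q₀) ⟩
    p * p * (X * (m * m)) * (n + 2)    <⟨ lower-arithmetic 1≤p (≤-trans (s≤s z≤n) 7≤n) (m^n>0 n q₀) ⟩
    m * (T₀ * suc T₀)                  ≤⟨ *-monoʳ-≤ m (*-mono-≤ T₀≤T (s≤s T₀≤T)) ⟩
    m * (T * suc T)                    ≤⟨ cost-≥ p n q (≤-trans (s≤s (s≤s z≤n)) 7≤n) σ ⟩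
    cost σ                             ∎
    where
    open ≤-Reasoning
    X T₀ T : ℕ
    X = n ^ q₀
    T₀ = p * (X + m)
    T = p * sumℕ (suc q) (n ^_)
    T₀≤T : T₀ ≤ T
    T₀≤T = *-monoʳ-≤ p (sumℕ-last-two q₀ (n ^_))

  upper-bound : 7 ≤ n → 1 ≤ p → cost σ₀ < p ^ 2 * n ^ (3 * q ∸ 1) * (n + 6)
  upper-bound 7≤n 1≤p = *-cancelˡ-< 2 _ _ (begin-strict
    2 * cost σ₀
      ≤⟨ *-monoʳ-≤ 2 (cost-≤ σ₀) ⟩
    2 * (s * A + 2 * m * B)
      ≡⟨ trans (*-distribˡ-+ 2 (s * A) (2 * m * B)) (cong₂ _+_ (x∙yz≈y∙xz 2 s A) (x∙yz≈y∙xz 2 (2 * m) B)) ⟩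
    s * (2 * A) + 2 * m * (2 * B)
      ≡⟨ cong₂ (λ x y → s * x + 2 * m * y) sum-pos-left sum-pos-top ⟩
    s * (p * (2 * m) * (2 * (p * m) + suc (p * (2 * m)))) + 2 * m * (p * m * (2 * 0 + suc (p * m)))
      <⟨ upper-arithmetic 1≤p 7≤n (m^n>0 n q₀) (geometric-≤ 7≤n q₀) ⟩
    2 * (p * p * (n ^ q₀ * (m * m)) * (n + 6))
      ≡⟨ cong (λ x → 2 * (x * (n + 6))) (sym (p²n^[3q∸1] p n q₀)) ⟩
    2 * (p ^ 2 * n ^ (3 * q ∸ 1) * (n + 6)) ∎)
    where
    open ≤-Reasoning
    s A B : ℕ
    s = sumℕ q (n ^_)
    A = sumFin p (λ c → sumFin (2 * m) (λ l → pos σ₀ (c , left l)))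
    B = sumFin p (λ c → sumFin m (λ j → pos σ₀ (c , righti (fromℕ q₀) j)))

lemma16 : (n p q : ℕ) .{{_ : NonZero n}} → 7 ≤ n → 1 ≤ p → 1 ≤ q → q ≤ n →
    ((σ : Ordering p n q) → p ^ 2 * n ^ (3 * q ∸ 1) * (n + 2) < cost σ)
    × (∃ λ (σ : Ordering p n q) → cost σ < p ^ 2 * n ^ (3 * q ∸ 1) * (n + 6))
lemma16 n p (suc q₀) 7≤n 1≤p _ _ = lower-bound p n q₀ 7≤n 1≤p , (σ₀ p n q₀ , upper-bound p n q₀ 7≤n 1≤p)
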